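{- Let $L=(V,E)$ be a $\bar{d}$-regular graph on $\bar{n}$ vertices. Consider the graph $\mathfrak{L}_k=(\mathfrak{V}_k, \mathfrak{E}_k)$ for $k\in\{1,\dots,\bar{n}-1\}$. Then $|\mathfrak{V}_k|=\binom{\bar{n}}{k}$ and \begin{equation} |\mathfrak{E}_k|=\dfrac{1}{2}\left(\bar{d}k\binom{\bar{n}}{k}-\bar{n}\bar{d}\binom{\bar{n}-2}{k-2}\right)=k(\bar{n}-k)\binom{\bar{n}}{k}\dfrac{\bar{d}}{2(\bar{n}-1)}. \end{equation}
   Context: For a finite simple connected graph $L=(V,E)$ and $k\in\{1,\dots,|V|-1\}$, the $k$-particle graph $\mathfrak{L}_k=(\mathfrak{V}_k,\mathfrak{E}_k)$ has vertex set $\mathfrak{V}_k$ consisting of all subsets of $V$ of size $k$, and $\langle\mathfrak{v},\mathfrak{w}\rangle\in\mathfrak{E}_k$ if and only if $\mathfrak{v}\triangle\mathfrak{w}=\{v,w\}$ with $\langle v,w\rangle\in E$. -}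

module Defs where

open import Data.Nat using (ℕ; zero; suc)
open import Data.Bool using (Bool; true; false; _∧_; if_then_else_; _≟_)
open import Data.Fin using (Fin)
open import Data.Fin.Subset using (Subset; _∪_; _─_; ⁅_⁆; ∣_∣)
open import Data.List using (List; []; _∷_; _++_; map; length; allFin)
open import Data.Bool.ListAction using (any)
open import Data.Vec using (Vec; []; _∷_)
open import Data.Vec.Properties using (≡-dec)
open import Data.Product using (_×_; _,_)
open import Relation.Binary.PropositionalEquality using (_≡_)
open import Relation.Nullary.Decidable using (⌊_⌋)
import Data.Nat as ℕ
open import Data.Nat.Combinatorics using (_C_)

-- A finite simple graph on the vertex set Fin n; the edge set E is given by
-- its characteristic function adj (adj v w ≡ true iff ⟨v,w⟩ ∈ E).
record SimpleGraph (n : ℕ) : Set where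
  field
    adj     : Fin n → Fin n → Bool
    adj-sym : ∀ v w → adj v w ≡ adj w v
    adj-irr : ∀ v → adj v v ≡ false
open SimpleGraph public

countB : {A : Set} → (A → Bool) → List A → ℕ
countB p []       = 0
countB p (x ∷ xs) = if p x then suc (countB p xs) else countB p xs

data Walk {n : ℕ} (L : SimpleGraph n) : Fin n → Fin n → Set where
  here : ∀ {v} → Walk L v v
  step : ∀ {u v w} → adj L u v ≡ true → Walk L v w → Walk L u w

Connected : {n : ℕ} → SimpleGraph n → Set
Connected L = ∀ v w → Walk L v w

degree : {n : ℕ} → SimpleGraph n → Fin n → ℕ
degree {n} L v = countB (adj L v) (allFin n)

Regular : {n : ℕ} → SimpleGraph n → ℕ → Set
Regular L d = ∀ v → degree L v ≡ d

allSubsets : (n : ℕ) → List (Subset n)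
allSubsets zero    = [] ∷ []
allSubsets (suc n) = map (true ∷_) (allSubsets n) ++ map (false ∷_) (allSubsets n)

pairs : {A : Set} → List A → List (A × A)
pairs []       = []
pairs (x ∷ xs) = map (x ,_) xs ++ pairs xs

_△_ : {n : ℕ} → Subset n → Subset n → Subset n
a △ b = (a ─ b) ∪ (b ─ a)

_==ˢ_ : {n : ℕ} → Subset n → Subset n → Bool
a ==ˢ b = ⌊ ≡-dec _≟_ a b ⌋

particleVertices : {n : ℕ} → SimpleGraph n → ℕ → List (Subset n)
particleVertices {n} L k = Data.List.filter (λ s → ∣ s ∣ ℕ.≟ k) (allSubsets n)
  where import Data.List

particleAdj : {n : ℕ} → SimpleGraph n → Subset n → Subset n → Bool
particleAdj {n} L a b =
  any (λ v → any (λ w → adj L v w ∧ ((a △ b) ==ˢ (⁅ v ⁆ ∪ ⁅ w ⁆))) (allFin n)) (allFin n)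

-- |𝔙_k| and |𝔈_k| (edges counted as unordered pairs of distinct vertices)
numParticleVertices : {n : ℕ} → SimpleGraph n → ℕ → ℕ
numParticleVertices L k = length (particleVertices L k)

numParticleEdges : {n : ℕ} → SimpleGraph n → ℕ → ℕ
numParticleEdges L k =
  countB (λ { (a , b) → particleAdj L a b }) (pairs (particleVertices L k))

binomMinus2 : ℕ → ℕ → ℕ
binomMinus2 m zero          = 0
binomMinus2 m (suc zero)    = 0
binomMinus2 m (suc (suc j)) = m C j

{-# OPTIONS --safe #-}
-- An ordered pair (a, b) of adjacent k-sets amounts to an oriented edge v → w of L (a △ b = {v, w},
-- v ∈ a) together with a k-set a containing v but not w. Hence twice the number of edges of 𝔏_k is
-- n d C(n − 2, k − 1) when L is d-regular, and both closed forms follow from Pascal's rule and the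
-- absorption identity k C(n, k) = n C(n − 1, k − 1). The count runs by induction on n, splitting the
-- k-sets according to whether they contain vertex 0.
module Submission where

open import Defs
import Algebra.Properties.CommutativeSemigroup as CommSemigroupProperties
open import Data.Bool using (Bool; true; false; _∧_; _∨_)
import Data.Bool as Bool
open import Data.Bool.Properties using (∧-zeroʳ; ∨-identityʳ; ∨-idem)
open import Data.Bool.ListAction using (or; any)
open import Data.Fin using (Fin; zero; suc)
open import Data.Fin.Subset using (Subset; _∪_; ⁅_⁆; ∣_∣; ⊥)
open import Data.Fin.Subset.Properties using (∪-identityˡ; ∪-identityʳ)
open import Data.List using (List; []; _∷_; _++_; map; length; filter; tabulate; allFin)
open import Data.Nat.ListAction using (sum)
open import Data.List.Properties using (filter-++; filter-none; filter-≐; length-++; length-map; map-tabulate; tabulate-cong)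
open import Data.List.Relation.Unary.All using (universal)
open import Data.List.Relation.Unary.All.Properties using (map⁺)
open import Data.Nat using (ℕ; zero; suc; _+_; _*_; _∸_; _≤_; _<_; s≤s; z≤n)
import Data.Nat as ℕ
open import Data.Nat.Properties
  using (+-assoc; +-comm; +-identityʳ; +-suc; +-cancelʳ-≡; *-assoc; *-identityʳ; *-zeroʳ; *-distribˡ-+; *-distribʳ-+;
         m∸n+n≡m; m≤n⇒m≤1+n; suc-injective; +-commutativeSemigroup)
open import Data.Nat.Tactic.RingSolver using (solve-∀)
open import Data.Nat.Combinatorics using (_C_; nC1≡n; nCk+nC[k+1]≡[n+1]C[k+1])
open import Data.Nat.Combinatorics.Specification using (k>n⇒nCk≡0)
open import Data.Product using (_×_; _,_)
open import Data.Vec using ([]; _∷_)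
open import Data.Vec.Properties using (≡-dec)
open import Function using (_∘_; id)
open import Level using (Level)
open import Relation.Binary.PropositionalEquality
open import Relation.Nullary using (contradiction)
open import Relation.Nullary.Decidable using (does; isYes≗does)
open import Relation.Unary using (Pred; Decidable)

open CommSemigroupProperties +-commutativeSemigroup using () renaming (interchange to +-interchange)

private
  variable
    A B : Set
    n : ℕ

boolToℕ : Bool → ℕ
boolToℕ true  = 1
boolToℕ false = 0

countB-∷ : (p : A → Bool) (x : A) (xs : List A) → countB p (x ∷ xs) ≡ boolToℕ (p x) + countB p xs
countB-∷ p x xs with p x
... | true  = refl
... | false = refl

countB-++ : (p : A → Bool) (xs ys : List A) → countB p (xs ++ ys) ≡ countB p xs + countB p ys
countB-++ p []       ys = refl
countB-++ p (x ∷ xs) ys = begin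
  countB p (x ∷ xs ++ ys)                           ≡⟨ countB-∷ p x (xs ++ ys) ⟩
  boolToℕ (p x) + countB p (xs ++ ys)               ≡⟨ cong (boolToℕ (p x) +_) (countB-++ p xs ys) ⟩
  boolToℕ (p x) + (countB p xs + countB p ys)       ≡⟨ +-assoc (boolToℕ (p x)) _ _ ⟨
  boolToℕ (p x) + countB p xs + countB p ys         ≡⟨ cong (_+ countB p ys) (countB-∷ p x xs) ⟨
  countB p (x ∷ xs) + countB p ys                   ∎
  where open ≡-Reasoning

countB-map : (p : B → Bool) (f : A → B) (xs : List A) → countB p (map f xs) ≡ countB (p ∘ f) xs
countB-map p f []       = refl
countB-map p f (x ∷ xs) with p (f x)
... | true  = cong suc (countB-map p f xs)
... | false = countB-map p f xs

countB-cong : {p q : A → Bool} → (∀ x → p x ≡ q x) → (xs : List A) → countB p xs ≡ countB q xs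
countB-cong e []       = refl
countB-cong {p = p} {q} e (x ∷ xs) = begin
  countB p (x ∷ xs)               ≡⟨ countB-∷ p x xs ⟩
  boolToℕ (p x) + countB p xs     ≡⟨ cong₂ _+_ (cong boolToℕ (e x)) (countB-cong e xs) ⟩
  boolToℕ (q x) + countB q xs     ≡⟨ countB-∷ q x xs ⟨
  countB q (x ∷ xs)               ∎
  where open ≡-Reasoning

countB-false : (xs : List A) → countB (λ _ → false) xs ≡ 0
countB-false []       = refl
countB-false (_ ∷ xs) = countB-false xs

countFin : (Fin n → Bool) → ℕ
countFin p = sum (tabulate (boolToℕ ∘ p))

countB-tabulate : (p : A → Bool) (f : Fin n → A) → countB p (tabulate f) ≡ countFin (p ∘ f)
countB-tabulate {n = zero}  p f = refl
countB-tabulate {n = suc n} p f =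
  trans (countB-∷ p (f zero) (tabulate (f ∘ suc))) (cong (boolToℕ (p (f zero)) +_) (countB-tabulate p (f ∘ suc)))

sum-tabulate-const : ∀ n d → sum (tabulate {n = n} (λ _ → d)) ≡ n * d
sum-tabulate-const zero    d = refl
sum-tabulate-const (suc n) d = cong (d +_) (sum-tabulate-const n d)

sum-tabulate-+ : (f g : Fin n → ℕ) → sum (tabulate (λ i → f i + g i)) ≡ sum (tabulate f) + sum (tabulate g)
sum-tabulate-+ {n = zero}  f g = refl
sum-tabulate-+ {n = suc n} f g = trans (cong (f zero + g zero +_) (sum-tabulate-+ (f ∘ suc) (g ∘ suc)))
  (+-interchange (f zero) (g zero) _ _)

or-tabulate-cong : {p q : Fin n → Bool} → (∀ i → p i ≡ q i) → or (tabulate p) ≡ or (tabulate q)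
or-tabulate-cong = cong or ∘ tabulate-cong

or-tabulate-false : {p : Fin n → Bool} → (∀ i → p i ≡ false) → or (tabulate p) ≡ false
or-tabulate-false {n = zero}  e = refl
or-tabulate-false {n = suc n} e rewrite e zero = or-tabulate-false (e ∘ suc)

any-allFin : (p : Fin n → Bool) → any p (allFin n) ≡ or (tabulate p)
any-allFin p = cong or (map-tabulate id p)

countPairs : (A → B → Bool) → List A → List B → ℕ
countPairs p []       ys = 0
countPairs p (x ∷ xs) ys = countB (p x) ys + countPairs p xs ys

countPairs-cong : {p q : A → B → Bool} → (∀ x y → p x y ≡ q x y) →
  (xs : List A) (ys : List B) → countPairs p xs ys ≡ countPairs q xs ys
countPairs-cong e []       ys = refl
countPairs-cong e (x ∷ xs) ys = cong₂ _+_ (countB-cong (e x) ys) (countPairs-cong e xs ys)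

countPairs-false : {p : A → B → Bool} → (∀ x y → p x y ≡ false) →
  (xs : List A) (ys : List B) → countPairs p xs ys ≡ 0
countPairs-false e []       ys = refl
countPairs-false e (x ∷ xs) ys = cong₂ _+_ (trans (countB-cong (e x) ys) (countB-false ys)) (countPairs-false e xs ys)

countPairs-[]ʳ : (p : A → B → Bool) (xs : List A) → countPairs p xs [] ≡ 0
countPairs-[]ʳ p []       = refl
countPairs-[]ʳ p (x ∷ xs) = countPairs-[]ʳ p xs

countPairs-∷ʳ : (p : A → B → Bool) (xs : List A) (y : B) (ys : List B) →
  countPairs p xs (y ∷ ys) ≡ countB (λ x → p x y) xs + countPairs p xs ys
countPairs-∷ʳ p []       y ys = refl
countPairs-∷ʳ p (x ∷ xs) y ys = begin
  countB (p x) (y ∷ ys) + countPairs p xs (y ∷ ys)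
    ≡⟨ cong₂ _+_ (countB-∷ (p x) y ys) (countPairs-∷ʳ p xs y ys) ⟩
  (boolToℕ (p x y) + countB (p x) ys) + (countB (λ x → p x y) xs + countPairs p xs ys)
    ≡⟨ +-interchange (boolToℕ (p x y)) _ _ _ ⟩
  (boolToℕ (p x y) + countB (λ x → p x y) xs) + (countB (p x) ys + countPairs p xs ys)
    ≡⟨ cong (_+ _) (countB-∷ (λ x → p x y) x xs) ⟨
  countB (λ x → p x y) (x ∷ xs) + countPairs p (x ∷ xs) ys
    ∎
  where open ≡-Reasoning

countPairs-flip : (p : A → B → Bool) (xs : List A) (ys : List B) →
  countPairs p xs ys ≡ countPairs (λ y x → p x y) ys xs
countPairs-flip p xs []       = countPairs-[]ʳ p xs
countPairs-flip p xs (y ∷ ys) = trans (countPairs-∷ʳ p xs y ys) (cong (_ +_) (countPairs-flip p xs ys))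

countPairs-++ˡ : (p : A → B → Bool) (xs xs′ : List A) (ys : List B) →
  countPairs p (xs ++ xs′) ys ≡ countPairs p xs ys + countPairs p xs′ ys
countPairs-++ˡ p []       xs′ ys = refl
countPairs-++ˡ p (x ∷ xs) xs′ ys = trans (cong (countB (p x) ys +_) (countPairs-++ˡ p xs xs′ ys))
  (sym (+-assoc (countB (p x) ys) _ _))

countPairs-++ʳ : (p : A → B → Bool) (xs : List A) (ys ys′ : List B) →
  countPairs p xs (ys ++ ys′) ≡ countPairs p xs ys + countPairs p xs ys′
countPairs-++ʳ p []       ys ys′ = refl
countPairs-++ʳ p (x ∷ xs) ys ys′ = trans (cong₂ _+_ (countB-++ (p x) ys ys′) (countPairs-++ʳ p xs ys ys′))
  (+-interchange (countB (p x) ys) _ _ _)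

countPairs-map : {A′ B′ : Set} (p : A → B → Bool) (f : A′ → A) (g : B′ → B) (xs : List A′) (ys : List B′) →
  countPairs p (map f xs) (map g ys) ≡ countPairs (λ x y → p (f x) (g y)) xs ys
countPairs-map p f g []       ys = refl
countPairs-map p f g (x ∷ xs) ys = cong₂ _+_ (countB-map (p (f x)) g ys) (countPairs-map p f g xs ys)

countPairs-map++map : {A′ : Set} (p : A → A → Bool) (f g : A′ → A) (xs ys xs′ ys′ : List A′) →
  countPairs p (map f xs ++ map g ys) (map f xs′ ++ map g ys′)
  ≡ (countPairs (λ a b → p (f a) (f b)) xs xs′ + countPairs (λ a b → p (f a) (g b)) xs ys′)
  + (countPairs (λ a b → p (g a) (f b)) ys xs′ + countPairs (λ a b → p (g a) (g b)) ys ys′)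
countPairs-map++map p f g xs ys xs′ ys′ = begin
  countPairs p (map f xs ++ map g ys) (map f xs′ ++ map g ys′)
    ≡⟨ countPairs-++ˡ p (map f xs) (map g ys) _ ⟩
  countPairs p (map f xs) (map f xs′ ++ map g ys′) + countPairs p (map g ys) (map f xs′ ++ map g ys′)
    ≡⟨ cong₂ _+_ (countPairs-++ʳ p (map f xs) _ _) (countPairs-++ʳ p (map g ys) _ _) ⟩
  _ ≡⟨ cong₂ _+_ (cong₂ _+_ (countPairs-map p f f xs xs′) (countPairs-map p f g xs ys′))
                 (cong₂ _+_ (countPairs-map p g f ys xs′) (countPairs-map p g g ys ys′)) ⟩
  _ ∎
  where open ≡-Reasoning

countPairs-const-∧ : (b : Bool) (q : A → B → Bool) (xs : List A) (ys : List B) →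
  countPairs (λ x y → b ∧ q x y) xs ys ≡ boolToℕ b * countPairs q xs ys
countPairs-const-∧ true  q xs ys = sym (+-identityʳ _)
countPairs-const-∧ false q xs ys = countPairs-false (λ _ _ → refl) xs ys

countB-pairs-twice : (p : A → A → Bool) → (∀ x y → p x y ≡ p y x) → (∀ x → p x x ≡ false) →
  (xs : List A) → countB (λ (x , y) → p x y) (pairs xs) + countB (λ (x , y) → p x y) (pairs xs) ≡ countPairs p xs xs
countB-pairs-twice p sym-p irr-p []       = refl
countB-pairs-twice p sym-p irr-p (x ∷ xs) = begin
  unordered (x ∷ xs) + unordered (x ∷ xs)
    ≡⟨ cong₂ _+_ unordered-∷ unordered-∷ ⟩
  (c + unordered xs) + (c + unordered xs)
    ≡⟨ +-interchange c _ c _ ⟩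
  (c + c) + (unordered xs + unordered xs)
    ≡⟨ cong ((c + c) +_) (countB-pairs-twice p sym-p irr-p xs) ⟩
  (c + c) + countPairs p xs xs
    ≡⟨ +-assoc c c _ ⟩
  c + (c + countPairs p xs xs)
    ≡⟨ cong₂ (λ z w → z + c + (w + countPairs p xs xs)) (cong boolToℕ (sym (irr-p x))) (countB-cong (sym-p x) xs) ⟩
  boolToℕ (p x x) + c + (countB (λ y → p y x) xs + countPairs p xs xs)
    ≡⟨ cong₂ _+_ (countB-∷ (p x) x xs) (countPairs-∷ʳ p xs x xs) ⟨
  countB (p x) (x ∷ xs) + countPairs p xs (x ∷ xs)
    ∎
  where
  open ≡-Reasoning
  unordered : List _ → ℕ
  unordered ys = countB (λ (x , y) → p x y) (pairs ys)
  c : ℕ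
  c = countB (p x) xs
  unordered-∷ : unordered (x ∷ xs) ≡ c + unordered xs
  unordered-∷ = trans (countB-++ _ (map (x ,_) xs) (pairs xs)) (cong (_+ unordered xs) (countB-map _ (x ,_) xs))

==ˢ-∷-same : (x : Bool) (a b : Subset n) → ((x ∷ a) ==ˢ (x ∷ b)) ≡ (a ==ˢ b)
==ˢ-∷-same true  a b =
  trans (isYes≗does (≡-dec Bool._≟_ (true ∷ a) (true ∷ b))) (sym (isYes≗does (≡-dec Bool._≟_ a b)))
==ˢ-∷-same false a b =
  trans (isYes≗does (≡-dec Bool._≟_ (false ∷ a) (false ∷ b))) (sym (isYes≗does (≡-dec Bool._≟_ a b)))

⊥==ˢ⁅v⁆∪s : (v : Fin n) (s : Subset n) → (⊥ ==ˢ (⁅ v ⁆ ∪ s)) ≡ false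
⊥==ˢ⁅v⁆∪s zero    (x ∷ s)     = refl
⊥==ˢ⁅v⁆∪s (suc v) (true ∷ s)  = refl
⊥==ˢ⁅v⁆∪s (suc v) (false ∷ s) = trans (==ˢ-∷-same false ⊥ (⁅ v ⁆ ∪ s)) (⊥==ˢ⁅v⁆∪s v s)

△-comm : (a b : Subset n) → a △ b ≡ b △ a
△-comm []          []          = refl
△-comm (true ∷ a)  (true ∷ b)  = cong (false ∷_) (△-comm a b)
△-comm (true ∷ a)  (false ∷ b) = cong (true ∷_) (△-comm a b)
△-comm (false ∷ a) (true ∷ b)  = cong (true ∷_) (△-comm a b)
△-comm (false ∷ a) (false ∷ b) = cong (false ∷_) (△-comm a b)

△-self : (a : Subset n) → a △ a ≡ ⊥
△-self []          = refl
△-self (true ∷ a)  = cong (false ∷_) (△-self a)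
△-self (false ∷ a) = cong (false ∷_) (△-self a)

△-∷-same : (x : Bool) (a b : Subset n) → (x ∷ a) △ (x ∷ b) ≡ false ∷ (a △ b)
△-∷-same true  a b = refl
△-∷-same false a b = refl

△==ˢ⊥ : (a b : Subset n) → ((a △ b) ==ˢ ⊥) ≡ (a ==ˢ b)
△==ˢ⊥ []          []          = refl
△==ˢ⊥ (true ∷ a)  (true ∷ b)  =
  trans (==ˢ-∷-same false (a △ b) ⊥) (trans (△==ˢ⊥ a b) (sym (==ˢ-∷-same true a b)))
△==ˢ⊥ (false ∷ a) (false ∷ b) =
  trans (==ˢ-∷-same false (a △ b) ⊥) (trans (△==ˢ⊥ a b) (sym (==ˢ-∷-same false a b)))
△==ˢ⊥ (true ∷ a)  (false ∷ b) = refl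
△==ˢ⊥ (false ∷ a) (true ∷ b)  = refl

isEdgeSet : SimpleGraph n → Subset n → Bool
isEdgeSet L s = or (tabulate λ v → or (tabulate λ w → adj L v w ∧ (s ==ˢ (⁅ v ⁆ ∪ ⁅ w ⁆))))

isSingletonIn : (Fin n → Bool) → Subset n → Bool
isSingletonIn c s = or (tabulate λ w → c w ∧ (s ==ˢ ⁅ w ⁆))

differByOneIn : (Fin n → Bool) → Subset n → Subset n → Bool
differByOneIn c a b = isSingletonIn c (a △ b)

differByOneIn-sym : (c : Fin n → Bool) (a b : Subset n) → differByOneIn c a b ≡ differByOneIn c b a
differByOneIn-sym c a b = cong (isSingletonIn c) (△-comm a b)

particleAdj≡isEdgeSet-△ : (L : SimpleGraph n) (a b : Subset n) → particleAdj L a b ≡ isEdgeSet L (a △ b)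
particleAdj≡isEdgeSet-△ {n} L a b = trans (any-allFin λ v → any (edgeWith v) (allFin n))
  (or-tabulate-cong λ v → any-allFin (edgeWith v))
  where
  edgeWith : Fin n → Fin n → Bool
  edgeWith v w = adj L v w ∧ ((a △ b) ==ˢ (⁅ v ⁆ ∪ ⁅ w ⁆))

particleAdj-sym : (L : SimpleGraph n) (a b : Subset n) → particleAdj L a b ≡ particleAdj L b a
particleAdj-sym L a b = begin
  particleAdj L a b    ≡⟨ particleAdj≡isEdgeSet-△ L a b ⟩
  isEdgeSet L (a △ b)  ≡⟨ cong (isEdgeSet L) (△-comm a b) ⟩
  isEdgeSet L (b △ a)  ≡⟨ particleAdj≡isEdgeSet-△ L b a ⟨
  particleAdj L b a    ∎
  where open ≡-Reasoning

particleAdj-irrefl : (L : SimpleGraph n) (a : Subset n) → particleAdj L a a ≡ false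
particleAdj-irrefl L a = begin
  particleAdj L a a    ≡⟨ particleAdj≡isEdgeSet-△ L a a ⟩
  isEdgeSet L (a △ a)  ≡⟨ cong (isEdgeSet L) (△-self a) ⟩
  isEdgeSet L ⊥        ≡⟨ or-tabulate-false (λ v → or-tabulate-false λ w →
                            trans (cong (adj L v w ∧_) (⊥==ˢ⁅v⁆∪s v ⁅ w ⁆)) (∧-zeroʳ _)) ⟩
  false                ∎
  where open ≡-Reasoning

deleteZero : SimpleGraph (suc n) → SimpleGraph n
deleteZero L = record
  { adj     = λ v w → adj L (suc v) (suc w)
  ; adj-sym = λ v w → adj-sym L (suc v) (suc w)
  ; adj-irr = λ v → adj-irr L (suc v)
  }

neighboursOfZero : SimpleGraph (suc n) → Fin n → Bool
neighboursOfZero L w = adj L zero (suc w)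

module _ (L : SimpleGraph (suc n)) where

  isEdgeSet-outside : (t : Subset n) → isEdgeSet L (false ∷ t) ≡ isEdgeSet (deleteZero L) t
  isEdgeSet-outside t = cong₂ _∨_
    (cong₂ _∨_ (∧-zeroʳ (adj L zero zero)) (or-tabulate-false λ w → ∧-zeroʳ (adj L zero (suc w))))
    (or-tabulate-cong λ v → cong₂ _∨_ (∧-zeroʳ (adj L (suc v) zero))
      (or-tabulate-cong λ w → cong (adj L (suc v) (suc w) ∧_) (==ˢ-∷-same false t _)))

  isEdgeSet-inside : (t : Subset n) → isEdgeSet L (true ∷ t) ≡ isSingletonIn (neighboursOfZero L) t
  isEdgeSet-inside t = trans (cong₂ _∨_ edgesAtZero edgesElsewhere) (∨-idem _)
    where
    edgesAtZero : or (tabulate λ w → adj L zero w ∧ ((true ∷ t) ==ˢ (⁅ zero ⁆ ∪ ⁅ w ⁆)))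
                ≡ isSingletonIn (neighboursOfZero L) t
    edgesAtZero = cong₂ _∨_ (cong (_∧ _) (adj-irr L zero)) (or-tabulate-cong λ w →
      cong (adj L zero (suc w) ∧_) (trans (==ˢ-∷-same true t _) (cong (t ==ˢ_) (∪-identityˡ ⁅ w ⁆))))
    edgesElsewhere :
      or (tabulate λ v → or (tabulate λ w → adj L (suc v) w ∧ ((true ∷ t) ==ˢ (⁅ suc v ⁆ ∪ ⁅ w ⁆))))
      ≡ isSingletonIn (neighboursOfZero L) t
    edgesElsewhere = or-tabulate-cong λ v → trans
      (cong₂ _∨_
        (cong₂ _∧_ (adj-sym L (suc v) zero) (trans (==ˢ-∷-same true t _) (cong (t ==ˢ_) (∪-identityʳ ⁅ v ⁆))))
        (or-tabulate-false λ w → ∧-zeroʳ (adj L (suc v) (suc w))))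
      (∨-identityʳ _)

  particleAdj-∷-same : (x : Bool) (a b : Subset n) → particleAdj L (x ∷ a) (x ∷ b) ≡ particleAdj (deleteZero L) a b
  particleAdj-∷-same x a b = begin
    particleAdj L (x ∷ a) (x ∷ b)        ≡⟨ particleAdj≡isEdgeSet-△ L (x ∷ a) (x ∷ b) ⟩
    isEdgeSet L ((x ∷ a) △ (x ∷ b))      ≡⟨ cong (isEdgeSet L) (△-∷-same x a b) ⟩
    isEdgeSet L (false ∷ (a △ b))        ≡⟨ isEdgeSet-outside (a △ b) ⟩
    isEdgeSet (deleteZero L) (a △ b)     ≡⟨ particleAdj≡isEdgeSet-△ (deleteZero L) a b ⟨
    particleAdj (deleteZero L) a b       ∎
    where open ≡-Reasoning

  particleAdj-inside-outside : (a b : Subset n) →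
    particleAdj L (true ∷ a) (false ∷ b) ≡ differByOneIn (neighboursOfZero L) a b
  particleAdj-inside-outside a b = trans (particleAdj≡isEdgeSet-△ L (true ∷ a) (false ∷ b)) (isEdgeSet-inside (a △ b))

  particleAdj-outside-inside : (a b : Subset n) →
    particleAdj L (false ∷ a) (true ∷ b) ≡ differByOneIn (neighboursOfZero L) a b
  particleAdj-outside-inside a b = trans (particleAdj≡isEdgeSet-△ L (false ∷ a) (true ∷ b)) (isEdgeSet-inside (a △ b))

  countPairs-particleAdj-split : (xs ys : List (Subset n)) →
    countPairs (particleAdj L) (map (true ∷_) xs ++ map (false ∷_) ys) (map (true ∷_) xs ++ map (false ∷_) ys)
    ≡ (countPairs (particleAdj (deleteZero L)) xs xs + countPairs (differByOneIn (neighboursOfZero L)) xs ys)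
    + (countPairs (differByOneIn (neighboursOfZero L)) xs ys + countPairs (particleAdj (deleteZero L)) ys ys)
  countPairs-particleAdj-split xs ys = trans (countPairs-map++map (particleAdj L) (true ∷_) (false ∷_) xs ys xs ys)
    (cong₂ _+_
      (cong₂ _+_ (countPairs-cong (particleAdj-∷-same true) xs xs) (countPairs-cong particleAdj-inside-outside xs ys))
      (cong₂ _+_ (trans (countPairs-cong particleAdj-outside-inside ys xs)
                        (trans (countPairs-flip (differByOneIn (neighboursOfZero L)) ys xs)
                               (countPairs-cong (λ a b → differByOneIn-sym (neighboursOfZero L) b a) xs ys)))
                 (countPairs-cong (particleAdj-∷-same false) ys ys)))

module _ (c : Fin (suc n) → Bool) where

  isSingletonIn-outside : (t : Subset n) → isSingletonIn c (false ∷ t) ≡ isSingletonIn (c ∘ suc) t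
  isSingletonIn-outside t = cong₂ _∨_ (∧-zeroʳ (c zero))
    (or-tabulate-cong λ w → cong (c (suc w) ∧_) (==ˢ-∷-same false t ⁅ w ⁆))

  isSingletonIn-inside : (t : Subset n) → isSingletonIn c (true ∷ t) ≡ c zero ∧ (t ==ˢ ⊥)
  isSingletonIn-inside t = trans
    (cong₂ _∨_ (cong (c zero ∧_) (==ˢ-∷-same true t ⊥)) (or-tabulate-false λ w → ∧-zeroʳ (c (suc w))))
    (∨-identityʳ _)

  differByOneIn-∷-same : (x : Bool) (a b : Subset n) → differByOneIn c (x ∷ a) (x ∷ b) ≡ differByOneIn (c ∘ suc) a b
  differByOneIn-∷-same x a b = trans (cong (isSingletonIn c) (△-∷-same x a b)) (isSingletonIn-outside (a △ b))

  countPairs-differByOneIn-inside-outside : (xs ys : List (Subset n)) →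
    countPairs (λ a b → differByOneIn c (true ∷ a) (false ∷ b)) xs ys ≡ boolToℕ (c zero) * countPairs _==ˢ_ xs ys
  countPairs-differByOneIn-inside-outside xs ys = trans
    (countPairs-cong (λ a b → trans (isSingletonIn-inside (a △ b)) (cong (c zero ∧_) (△==ˢ⊥ a b))) xs ys)
    (countPairs-const-∧ (c zero) _==ˢ_ xs ys)

  countPairs-differByOneIn-outside-inside : (xs ys : List (Subset n)) →
    countPairs (λ a b → differByOneIn c (false ∷ a) (true ∷ b)) xs ys ≡ boolToℕ (c zero) * countPairs _==ˢ_ xs ys
  countPairs-differByOneIn-outside-inside xs ys = trans
    (countPairs-cong (λ a b → trans (isSingletonIn-inside (a △ b)) (cong (c zero ∧_) (△==ˢ⊥ a b))) xs ys)
    (countPairs-const-∧ (c zero) _==ˢ_ xs ys)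

binomMinus1 : ℕ → ℕ → ℕ
binomMinus1 n zero    = 0
binomMinus1 n (suc k) = n C k

binomMinus1-pascal : ∀ n k → binomMinus1 n k + n C k ≡ suc n C k
binomMinus1-pascal n zero    = refl
binomMinus1-pascal n (suc k) = nCk+nC[k+1]≡[n+1]C[k+1] n k

binomMinus2-suc : ∀ m j → binomMinus2 m (suc j) ≡ binomMinus1 m j
binomMinus2-suc m zero    = refl
binomMinus2-suc m (suc j) = refl

[k+1]*[n+1]C[k+1]≡[n+1]*nCk : ∀ n k → suc k * (suc n C suc k) ≡ suc n * (n C k)
[k+1]*[n+1]C[k+1]≡[n+1]*nCk zero zero = refl
[k+1]*[n+1]C[k+1]≡[n+1]*nCk zero (suc k) = begin
  suc (suc k) * (1 C suc (suc k)) ≡⟨ cong (suc (suc k) *_) (k>n⇒nCk≡0 {1} {suc (suc k)} (s≤s (s≤s z≤n))) ⟩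
  suc (suc k) * 0                 ≡⟨ *-zeroʳ (suc (suc k)) ⟩
  0                               ≡⟨ cong (1 *_) (k>n⇒nCk≡0 {0} {suc k} (s≤s z≤n)) ⟨
  1 * (0 C suc k)                 ∎
  where open ≡-Reasoning
[k+1]*[n+1]C[k+1]≡[n+1]*nCk (suc n) zero = begin
  1 * (suc (suc n) C 1)   ≡⟨ +-identityʳ _ ⟩
  suc (suc n) C 1         ≡⟨ nC1≡n (suc (suc n)) ⟩
  suc (suc n)             ≡⟨ *-identityʳ (suc (suc n)) ⟨
  suc (suc n) * 1         ∎
  where open ≡-Reasoning
[k+1]*[n+1]C[k+1]≡[n+1]*nCk (suc n) (suc k) = begin
  suc (suc k) * (suc (suc n) C suc (suc k))
    ≡⟨ cong (suc (suc k) *_) (nCk+nC[k+1]≡[n+1]C[k+1] (suc n) (suc k)) ⟨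
  suc (suc k) * (suc n C suc k + suc n C suc (suc k))
    ≡⟨ expand (suc k) (suc n C suc k) (suc n C suc (suc k)) ⟩
  (suc k * (suc n C suc k) + suc n C suc k) + suc (suc k) * (suc n C suc (suc k))
    ≡⟨ cong₂ (λ x y → (x + suc n C suc k) + y)
             ([k+1]*[n+1]C[k+1]≡[n+1]*nCk n k) ([k+1]*[n+1]C[k+1]≡[n+1]*nCk n (suc k)) ⟩
  (suc n * (n C k) + suc n C suc k) + suc n * (n C suc k)
    ≡⟨ collect (suc n) (n C k) (suc n C suc k) (n C suc k) ⟩
  suc n * (n C k + n C suc k) + suc n C suc k
    ≡⟨ cong (λ x → suc n * x + suc n C suc k) (nCk+nC[k+1]≡[n+1]C[k+1] n k) ⟩
  suc n * (suc n C suc k) + suc n C suc k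
    ≡⟨ suc-* (suc n) (suc n C suc k) ⟩
  suc (suc n) * (suc n C suc k) ∎
  where
  open ≡-Reasoning
  expand : ∀ k a b → suc k * (a + b) ≡ (k * a + a) + suc k * b
  expand = solve-∀
  collect : ∀ n a c b → (n * a + c) + n * b ≡ n * (a + b) + c
  collect = solve-∀
  suc-* : ∀ n a → n * a + a ≡ suc n * a
  suc-* = solve-∀

[n∸k]*[n+1]C[k+1]≡[n+1]*nC[k+1] : ∀ {n k} → k ≤ n → (n ∸ k) * (suc n C suc k) ≡ suc n * (n C suc k)
[n∸k]*[n+1]C[k+1]≡[n+1]*nC[k+1] {n} {k} k≤n = +-cancelʳ-≡ (suc k * (suc n C suc k)) _ _ (begin
  (n ∸ k) * (suc n C suc k) + suc k * (suc n C suc k)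
    ≡⟨ *-distribʳ-+ (suc n C suc k) (n ∸ k) (suc k) ⟨
  ((n ∸ k) + suc k) * (suc n C suc k)
    ≡⟨ cong (_* (suc n C suc k)) (trans (+-suc (n ∸ k) k) (cong suc (m∸n+n≡m k≤n))) ⟩
  suc n * (suc n C suc k)
    ≡⟨ cong (suc n *_) (nCk+nC[k+1]≡[n+1]C[k+1] n k) ⟨
  suc n * (n C k + n C suc k)
    ≡⟨ *-distribˡ-+ (suc n) (n C k) (n C suc k) ⟩
  suc n * (n C k) + suc n * (n C suc k)
    ≡⟨ +-comm (suc n * (n C k)) _ ⟩
  suc n * (n C suc k) + suc n * (n C k)
    ≡⟨ cong (suc n * (n C suc k) +_) ([k+1]*[n+1]C[k+1]≡[n+1]*nCk n k) ⟨
  suc n * (n C suc k) + suc k * (suc n C suc k) ∎)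
  where open ≡-Reasoning

filter-map : {ℓ : Level} {P : Pred B ℓ} (P? : Decidable P) (f : A → B) (xs : List A) →
  filter P? (map f xs) ≡ map f (filter (P? ∘ f) xs)
filter-map P? f []       = refl
filter-map P? f (x ∷ xs) with does (P? (f x))
... | true  = cong (f x ∷_) (filter-map P? f xs)
... | false = filter-map P? f xs

-- subsetsOfSize⁻ n k lists the subsets of size k ∸ 1, except that it is empty for k = 0.
mutual
  subsetsOfSize : ∀ n → ℕ → List (Subset n)
  subsetsOfSize zero    zero    = [] ∷ []
  subsetsOfSize zero    (suc k) = []
  subsetsOfSize (suc n) k       = map (true ∷_) (subsetsOfSize⁻ n k) ++ map (false ∷_) (subsetsOfSize n k)

  subsetsOfSize⁻ : ∀ n → ℕ → List (Subset n)
  subsetsOfSize⁻ n zero    = []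
  subsetsOfSize⁻ n (suc k) = subsetsOfSize n k

particleVertices≡subsetsOfSize : (L : SimpleGraph n) (k : ℕ) → particleVertices L k ≡ subsetsOfSize n k
particleVertices≡subsetsOfSize {n} _ = filter-size n
  where
  filter-size : ∀ n k → filter (λ s → ∣ s ∣ ℕ.≟ k) (allSubsets n) ≡ subsetsOfSize n k
  filter-size zero    zero    = refl
  filter-size zero    (suc k) = refl
  filter-size (suc n) k = trans (filter-++ (λ s → ∣ s ∣ ℕ.≟ k) (map (true ∷_) (allSubsets n)) _)
    (cong₂ _++_ (inside k) (trans (filter-map (λ s → ∣ s ∣ ℕ.≟ k) (false ∷_) (allSubsets n))
                                  (cong (map (false ∷_)) (filter-size n k))))
    where
    inside : ∀ k →
      filter (λ s → ∣ s ∣ ℕ.≟ k) (map (true ∷_) (allSubsets n)) ≡ map (true ∷_) (subsetsOfSize⁻ n k)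
    inside zero    = filter-none (λ s → ∣ s ∣ ℕ.≟ zero) (map⁺ (universal (λ _ ()) (allSubsets n)))
    inside (suc k) = trans (filter-map (λ s → ∣ s ∣ ℕ.≟ suc k) (true ∷_) (allSubsets n))
      (cong (map (true ∷_)) (trans (filter-≐ _ (λ s → ∣ s ∣ ℕ.≟ k) (suc-injective , cong suc) (allSubsets n))
                                   (filter-size n k)))

length-subsetsOfSize : ∀ n k → length (subsetsOfSize n k) ≡ n C k
length-subsetsOfSize zero    zero    = refl
length-subsetsOfSize zero    (suc k) = sym (k>n⇒nCk≡0 {0} {suc k} (s≤s z≤n))
length-subsetsOfSize (suc n) k       = begin
  length (map (true ∷_) (subsetsOfSize⁻ n k) ++ map (false ∷_) (subsetsOfSize n k))
    ≡⟨ length-++ (map (true ∷_) (subsetsOfSize⁻ n k)) ⟩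
  length (map (true ∷_) (subsetsOfSize⁻ n k)) + length (map (false ∷_) (subsetsOfSize n k))
    ≡⟨ cong₂ _+_ (trans (length-map _ (subsetsOfSize⁻ n k)) (length⁻ k))
                 (trans (length-map _ (subsetsOfSize n k)) (length-subsetsOfSize n k)) ⟩
  binomMinus1 n k + n C k
    ≡⟨ binomMinus1-pascal n k ⟩
  suc n C k ∎
  where
  open ≡-Reasoning
  length⁻ : ∀ k → length (subsetsOfSize⁻ n k) ≡ binomMinus1 n k
  length⁻ zero    = refl
  length⁻ (suc k) = length-subsetsOfSize n k

-- Double counting the edges of the particle graph

countPairs-==ˢ-∷ : (xs ys xs′ ys′ : List (Subset n)) →
  countPairs _==ˢ_ (map (true ∷_) xs ++ map (false ∷_) ys) (map (true ∷_) xs′ ++ map (false ∷_) ys′)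
  ≡ countPairs _==ˢ_ xs xs′ + countPairs _==ˢ_ ys ys′
countPairs-==ˢ-∷ xs ys xs′ ys′ = trans (countPairs-map++map _==ˢ_ (true ∷_) (false ∷_) xs ys xs′ ys′)
  (cong₂ _+_
    (trans (cong₂ _+_ (countPairs-cong (==ˢ-∷-same true) xs xs′)
                      (countPairs-false {p = λ _ _ → false} (λ _ _ → refl) xs ys′))
           (+-identityʳ _))
    (cong₂ _+_ (countPairs-false {p = λ _ _ → false} (λ _ _ → refl) ys xs′)
               (countPairs-cong (==ˢ-∷-same false) ys ys′)))

mutual
  countPairs-==ˢ-subsetsOfSize-≢ : ∀ n i j → i ≢ j →
    countPairs _==ˢ_ (subsetsOfSize n i) (subsetsOfSize n j) ≡ 0
  countPairs-==ˢ-subsetsOfSize-≢ zero    zero    zero    i≢j = contradiction refl i≢j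
  countPairs-==ˢ-subsetsOfSize-≢ zero    zero    (suc j) i≢j = refl
  countPairs-==ˢ-subsetsOfSize-≢ zero    (suc i) j       i≢j = refl
  countPairs-==ˢ-subsetsOfSize-≢ (suc n) i       j       i≢j =
    trans (countPairs-==ˢ-∷ (subsetsOfSize⁻ n i) (subsetsOfSize n i) (subsetsOfSize⁻ n j) (subsetsOfSize n j))
          (cong₂ _+_ (countPairs-==ˢ-subsetsOfSize⁻-≢ n i j i≢j) (countPairs-==ˢ-subsetsOfSize-≢ n i j i≢j))

  countPairs-==ˢ-subsetsOfSize⁻-≢ : ∀ n i j → i ≢ j →
    countPairs _==ˢ_ (subsetsOfSize⁻ n i) (subsetsOfSize⁻ n j) ≡ 0
  countPairs-==ˢ-subsetsOfSize⁻-≢ n zero    j       i≢j = refl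
  countPairs-==ˢ-subsetsOfSize⁻-≢ n (suc i) zero    i≢j = countPairs-[]ʳ _==ˢ_ (subsetsOfSize n i)
  countPairs-==ˢ-subsetsOfSize⁻-≢ n (suc i) (suc j) i≢j = countPairs-==ˢ-subsetsOfSize-≢ n i j (i≢j ∘ cong suc)

countPairs-==ˢ-subsetsOfSize : ∀ n i → countPairs _==ˢ_ (subsetsOfSize n i) (subsetsOfSize n i) ≡ n C i
countPairs-==ˢ-subsetsOfSize zero    zero    = refl
countPairs-==ˢ-subsetsOfSize zero    (suc i) = sym (k>n⇒nCk≡0 {0} {suc i} (s≤s z≤n))
countPairs-==ˢ-subsetsOfSize (suc n) i       =
  trans (countPairs-==ˢ-∷ (subsetsOfSize⁻ n i) (subsetsOfSize n i) (subsetsOfSize⁻ n i) (subsetsOfSize n i))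
        (trans (cong₂ _+_ (diagonal⁻ i) (countPairs-==ˢ-subsetsOfSize n i)) (binomMinus1-pascal n i))
  where
  diagonal⁻ : ∀ i → countPairs _==ˢ_ (subsetsOfSize⁻ n i) (subsetsOfSize⁻ n i) ≡ binomMinus1 n i
  diagonal⁻ zero    = refl
  diagonal⁻ (suc i) = countPairs-==ˢ-subsetsOfSize n i

countFin*pascal : (c : Fin n → Bool) (j : ℕ) →
  countFin c * binomMinus1 (n ∸ 1) j + countFin c * ((n ∸ 1) C j) ≡ countFin c * (n C j)
countFin*pascal {zero}  c j = refl
countFin*pascal {suc n} c j = trans (sym (*-distribˡ-+ (countFin c) _ _)) (cong (countFin c *_) (binomMinus1-pascal n j))

-- Here b = a ∪ {w} with w ∉ a and c w, and each such w arises from (n ∸ 1) C j sets a.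
countPairs-differByOneIn : (c : Fin n → Bool) (j : ℕ) →
  countPairs (differByOneIn c) (subsetsOfSize n j) (subsetsOfSize n (suc j)) ≡ countFin c * ((n ∸ 1) C j)
countPairs-differByOneIn {zero}  c j = countPairs-[]ʳ (differByOneIn c) (subsetsOfSize zero j)
countPairs-differByOneIn {suc m} c j = begin
  countPairs (differByOneIn c) (map (true ∷_) (subsetsOfSize⁻ m j) ++ map (false ∷_) (subsetsOfSize m j))
                               (map (true ∷_) (subsetsOfSize m j) ++ map (false ∷_) (subsetsOfSize m (suc j)))
    ≡⟨ countPairs-map++map (differByOneIn c) (true ∷_) (false ∷_) (subsetsOfSize⁻ m j) (subsetsOfSize m j)
                                                                  (subsetsOfSize m j) (subsetsOfSize m (suc j)) ⟩
  _ ≡⟨ cong₂ _+_ (cong₂ _+_ (bothInside j) (insideOutside j)) (cong₂ _+_ outsideInside bothOutside) ⟩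
  (K * binomMinus1 (m ∸ 1) j + 0) + (c₀ * (m C j) + K * ((m ∸ 1) C j))
    ≡⟨ regroup (K * binomMinus1 (m ∸ 1) j) c₀ (m C j) (K * ((m ∸ 1) C j)) ⟩
  c₀ * (m C j) + (K * binomMinus1 (m ∸ 1) j + K * ((m ∸ 1) C j))
    ≡⟨ cong (c₀ * (m C j) +_) (countFin*pascal (c ∘ suc) j) ⟩
  c₀ * (m C j) + K * (m C j)
    ≡⟨ *-distribʳ-+ (m C j) c₀ K ⟨
  countFin c * (m C j) ∎
  where
  open ≡-Reasoning
  c₀ K : ℕ
  c₀ = boolToℕ (c zero)
  K  = countFin (c ∘ suc)
  regroup : ∀ a b x y → (a + 0) + (b * x + y) ≡ b * x + (a + y)
  regroup = solve-∀
  bothInside : ∀ j →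
    countPairs (λ a b → differByOneIn c (true ∷ a) (true ∷ b)) (subsetsOfSize⁻ m j) (subsetsOfSize m j)
    ≡ K * binomMinus1 (m ∸ 1) j
  bothInside zero    = sym (*-zeroʳ K)
  bothInside (suc j) = trans (countPairs-cong (differByOneIn-∷-same c true) (subsetsOfSize m j) (subsetsOfSize m (suc j)))
                             (countPairs-differByOneIn (c ∘ suc) j)
  insideOutside : ∀ j →
    countPairs (λ a b → differByOneIn c (true ∷ a) (false ∷ b)) (subsetsOfSize⁻ m j) (subsetsOfSize m (suc j)) ≡ 0
  insideOutside zero    = refl
  insideOutside (suc j) = trans (countPairs-differByOneIn-inside-outside c (subsetsOfSize m j) (subsetsOfSize m (suc (suc j))))
    (trans (cong (c₀ *_) (countPairs-==ˢ-subsetsOfSize-≢ m j (suc (suc j)) (λ ()))) (*-zeroʳ c₀))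
  outsideInside : countPairs (λ a b → differByOneIn c (false ∷ a) (true ∷ b)) (subsetsOfSize m j) (subsetsOfSize m j)
                ≡ c₀ * (m C j)
  outsideInside = trans (countPairs-differByOneIn-outside-inside c (subsetsOfSize m j) (subsetsOfSize m j))
                        (cong (c₀ *_) (countPairs-==ˢ-subsetsOfSize m j))
  bothOutside : countPairs (λ a b → differByOneIn c (false ∷ a) (false ∷ b)) (subsetsOfSize m j) (subsetsOfSize m (suc j))
              ≡ K * ((m ∸ 1) C j)
  bothOutside = trans (countPairs-cong (differByOneIn-∷-same c false) (subsetsOfSize m j) (subsetsOfSize m (suc j)))
                      (countPairs-differByOneIn (c ∘ suc) j)

degreeSum : SimpleGraph n → ℕ
degreeSum L = sum (tabulate λ v → countFin (adj L v))

degreeSum-regular : (L : SimpleGraph n) {d : ℕ} → Regular L d → degreeSum L ≡ n * d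
degreeSum-regular {n} L {d} regular = trans
  (cong sum (tabulate-cong λ v → trans (sym (countB-tabulate (adj L v) id)) (regular v)))
  (sum-tabulate-const n d)

degreeSum-deleteZero : (L : SimpleGraph (suc n)) →
  degreeSum L ≡ countFin (neighboursOfZero L) + (countFin (neighboursOfZero L) + degreeSum (deleteZero L))
degreeSum-deleteZero L = cong₂ _+_
  (cong (λ b → boolToℕ b + countFin (neighboursOfZero L)) (adj-irr L zero))
  (trans (sum-tabulate-+ (λ v → boolToℕ (adj L (suc v) zero)) (λ v → countFin (adj (deleteZero L) v)))
         (cong (_+ degreeSum (deleteZero L)) (cong sum (tabulate-cong λ v → cong boolToℕ (adj-sym L (suc v) zero)))))

degreeSum*pascal : (L : SimpleGraph n) (j : ℕ) →
  degreeSum L * binomMinus1 (n ∸ 2) j + degreeSum L * ((n ∸ 2) C j) ≡ degreeSum L * ((n ∸ 1) C j)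
degreeSum*pascal {zero}        L j = refl
degreeSum*pascal {suc zero}    L j rewrite adj-irr L zero = refl
degreeSum*pascal {suc (suc n)} L j =
  trans (sym (*-distribˡ-+ (degreeSum L) _ _)) (cong (degreeSum L *_) (binomMinus1-pascal n j))

countPairs-particleAdj : (L : SimpleGraph n) (k : ℕ) →
  countPairs (particleAdj L) (subsetsOfSize n k) (subsetsOfSize n k) ≡ degreeSum L * binomMinus1 (n ∸ 2) k
countPairs-particleAdj {zero}  L zero    = refl
countPairs-particleAdj {zero}  L (suc k) = refl
countPairs-particleAdj {suc m} L zero    = begin
  countPairs (particleAdj L) (map (false ∷_) (subsetsOfSize m zero)) (map (false ∷_) (subsetsOfSize m zero))
    ≡⟨ countPairs-particleAdj-split L [] (subsetsOfSize m zero) ⟩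
  countPairs (particleAdj (deleteZero L)) (subsetsOfSize m zero) (subsetsOfSize m zero)
    ≡⟨ countPairs-particleAdj (deleteZero L) zero ⟩
  degreeSum (deleteZero L) * 0
    ≡⟨ *-zeroʳ (degreeSum (deleteZero L)) ⟩
  0
    ≡⟨ *-zeroʳ (degreeSum L) ⟨
  degreeSum L * 0 ∎
  where open ≡-Reasoning
countPairs-particleAdj {suc m} L (suc j) = begin
  countPairs (particleAdj L) (map (true ∷_) (subsetsOfSize m j) ++ map (false ∷_) (subsetsOfSize m (suc j)))
                             (map (true ∷_) (subsetsOfSize m j) ++ map (false ∷_) (subsetsOfSize m (suc j)))
    ≡⟨ countPairs-particleAdj-split L (subsetsOfSize m j) (subsetsOfSize m (suc j)) ⟩
  _ ≡⟨ cong₂ _+_ (cong₂ _+_ (countPairs-particleAdj L′ j) extensions)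
                 (cong₂ _+_ extensions (countPairs-particleAdj L′ (suc j))) ⟩
  (D′ * binomMinus1 (m ∸ 2) j + K * c) + (K * c + D′ * ((m ∸ 2) C j))
    ≡⟨ regroup (D′ * binomMinus1 (m ∸ 2) j) (D′ * ((m ∸ 2) C j)) (K * c) (K * c) ⟩
  (K * c + K * c) + (D′ * binomMinus1 (m ∸ 2) j + D′ * ((m ∸ 2) C j))
    ≡⟨ cong (K * c + K * c +_) (degreeSum*pascal L′ j) ⟩
  (K * c + K * c) + D′ * c
    ≡⟨ factor K D′ c ⟩
  (K + (K + D′)) * c
    ≡⟨ cong (_* c) (degreeSum-deleteZero L) ⟨
  degreeSum L * c ∎
  where
  open ≡-Reasoning
  L′ : SimpleGraph m
  L′ = deleteZero L
  D′ K c : ℕ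
  D′ = degreeSum L′
  K  = countFin (neighboursOfZero L)
  c  = (m ∸ 1) C j
  extensions : countPairs (differByOneIn (neighboursOfZero L)) (subsetsOfSize m j) (subsetsOfSize m (suc j)) ≡ K * c
  extensions = countPairs-differByOneIn (neighboursOfZero L) j
  regroup : ∀ p q x y → (p + x) + (y + q) ≡ (x + y) + (p + q)
  regroup = solve-∀
  factor : ∀ K D x → (K * x + K * x) + D * x ≡ (K + (K + D)) * x
  factor = solve-∀

twiceNumParticleEdges : (L : SimpleGraph n) (k : ℕ) → 2 * numParticleEdges L k ≡ degreeSum L * binomMinus1 (n ∸ 2) k
twiceNumParticleEdges {n} L k = begin
  2 * numParticleEdges L k
    ≡⟨ cong (numParticleEdges L k +_) (+-identityʳ (numParticleEdges L k)) ⟩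
  numParticleEdges L k + numParticleEdges L k
    ≡⟨ countB-pairs-twice (particleAdj L) (particleAdj-sym L) (particleAdj-irrefl L) (particleVertices L k) ⟩
  countPairs (particleAdj L) (particleVertices L k) (particleVertices L k)
    ≡⟨ cong (λ vs → countPairs (particleAdj L) vs vs) (particleVertices≡subsetsOfSize L k) ⟩
  countPairs (particleAdj L) (subsetsOfSize n k) (subsetsOfSize n k)
    ≡⟨ countPairs-particleAdj L k ⟩
  degreeSum L * binomMinus1 (n ∸ 2) k ∎
  where open ≡-Reasoning

edgeCount-binomMinus2 : ∀ m j d E → 2 * E ≡ suc (suc m) * d * (m C j) →
  2 * E + suc (suc m) * d * binomMinus2 m (suc j) ≡ d * suc j * (suc (suc m) C suc j)
edgeCount-binomMinus2 m j d E twiceE = begin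
  2 * E + n′ * d * binomMinus2 m (suc j)
    ≡⟨ cong₂ (λ x y → x + n′ * d * y) twiceE (binomMinus2-suc m j) ⟩
  n′ * d * (m C j) + n′ * d * binomMinus1 m j
    ≡⟨ *-distribˡ-+ (n′ * d) (m C j) (binomMinus1 m j) ⟨
  n′ * d * (m C j + binomMinus1 m j)
    ≡⟨ cong (n′ * d *_) (trans (+-comm (m C j) (binomMinus1 m j)) (binomMinus1-pascal m j)) ⟩
  n′ * d * (suc m C j)
    ≡⟨ reorder n′ d (suc m C j) ⟩
  d * (n′ * (suc m C j))
    ≡⟨ cong (d *_) ([k+1]*[n+1]C[k+1]≡[n+1]*nCk (suc m) j) ⟨
  d * (suc j * (n′ C suc j))
    ≡⟨ *-assoc d (suc j) (n′ C suc j) ⟨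
  d * suc j * (n′ C suc j) ∎
  where
  open ≡-Reasoning
  n′ : ℕ
  n′ = suc (suc m)
  reorder : ∀ n d x → n * d * x ≡ d * (n * x)
  reorder = solve-∀

edgeCount-[n∸1] : ∀ m j d E → j ≤ m → 2 * E ≡ suc (suc m) * d * (m C j) →
  2 * suc m * E ≡ suc j * (suc m ∸ j) * (suc (suc m) C suc j) * d
edgeCount-[n∸1] m j d E j≤m twiceE = begin
  2 * suc m * E
    ≡⟨ reorder₁ (suc m) E ⟩
  suc m * (2 * E)
    ≡⟨ cong (suc m *_) twiceE ⟩
  suc m * (n′ * d * (m C j))
    ≡⟨ reorder₂ (suc m) n′ d (m C j) ⟩
  n′ * d * (suc m * (m C j))
    ≡⟨ cong (n′ * d *_) ([k+1]*[n+1]C[k+1]≡[n+1]*nCk m j) ⟨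
  n′ * d * (suc j * (suc m C suc j))
    ≡⟨ reorder₃ n′ d (suc j) (suc m C suc j) ⟩
  suc j * d * (n′ * (suc m C suc j))
    ≡⟨ cong (suc j * d *_) ([n∸k]*[n+1]C[k+1]≡[n+1]*nC[k+1] (m≤n⇒m≤1+n j≤m)) ⟨
  suc j * d * ((suc m ∸ j) * (n′ C suc j))
    ≡⟨ reorder₄ (suc j) d (suc m ∸ j) (n′ C suc j) ⟩
  suc j * (suc m ∸ j) * (n′ C suc j) * d ∎
  where
  open ≡-Reasoning
  n′ : ℕ
  n′ = suc (suc m)
  reorder₁ : ∀ a E → 2 * a * E ≡ a * (2 * E)
  reorder₁ = solve-∀
  reorder₂ : ∀ a n d x → a * (n * d * x) ≡ n * d * (a * x)
  reorder₂ = solve-∀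
  reorder₃ : ∀ n d k x → n * d * (k * x) ≡ k * d * (n * x)
  reorder₃ = solve-∀
  reorder₄ : ∀ k d a x → k * d * (a * x) ≡ k * a * x * d
  reorder₄ = solve-∀

proposition5p1 : (n d k : ℕ) (L : SimpleGraph n) → Connected L → Regular L d →
    1 ≤ k → k < n →
    (numParticleVertices L k ≡ n C k)
    × (2 * numParticleEdges L k + n * d * binomMinus2 (n ∸ 2) k ≡ d * k * (n C k))
    × (2 * (n ∸ 1) * numParticleEdges L k ≡ k * (n ∸ k) * (n C k) * d)
proposition5p1 (suc (suc m)) d (suc j) L _ regular (s≤s z≤n) (s≤s (s≤s j≤m)) =
    trans (cong length (particleVertices≡subsetsOfSize L (suc j))) (length-subsetsOfSize (suc (suc m)) (suc j))
  , edgeCount-binomMinus2 m j d E twiceE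
  , edgeCount-[n∸1] m j d E j≤m twiceE
  where
  E : ℕ
  E = numParticleEdges L (suc j)
  twiceE : 2 * E ≡ suc (suc m) * d * (m C j)
  twiceE = trans (twiceNumParticleEdges L (suc j)) (cong (_* (m C j)) (degreeSum-regular L regular))
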